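{- Let $A$ be a finite alphabet, $X$ a set and $(o,\delta):X\to\mathbb{B}\times\mathcal{P}_\omega(X^*)^A$, with extension $(\mathcal{P}_\omega(X^*),(\hat o,\hat\delta))$, and let $X_{\mathrm{nul}}=\{x\in X\mid o(x)=1\}$. Then for all $s\in(X_{\mathrm{nul}})^*$, $t\in X^*$ and $a\in A$: $\{t\}_a\subseteq\{st\}_a$.
   Context: $\mathbb{B}=\{0,1\}$; $\mathcal{P}_\omega(X^*)$ is the set of finite sets of words over $X$ with concatenation. Write $x_a:=\delta(x)(a)$, $S_a:=\hat\delta(S)(a)$; $i(1)=\{\epsilon\}$, $i(0)=\emptyset$. Extension: $\hat o(\{\epsilon\})=1$, $\{\epsilon\}_a=\emptyset$; for $x\in X$, $w\in X^*$: $\hat o(\{xw\})=o(x)\wedge\hat o(\{w\})$, $\{xw\}_a=x_a\{w\}\cup i(o(x))\{w\}_a$; for finite $S$: $\hat o(S)=\bigvee_{s\in S}\hat o(\{s\})$, $S_a=\bigcup_{s\in S}\{s\}_a$. -}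

module Defs where

open import Data.Bool using (Bool; true; false)
open import Data.List using (List; []; _∷_; _++_; concatMap; map)

-- Finite sets of words over X are represented as lists of words (List (List X)),
-- read up to membership; inclusion is Data.List.Relation.Binary.Subset.Propositional._⊆_.

module Extension {X A : Set} (o : X → Bool) (δ : X → A → List (List X)) where

  _·_ : List (List X) → List (List X) → List (List X)
  S · T = concatMap (λ s → map (s ++_) T) S

  i : Bool → List (List X)
  i true  = [] ∷ []
  i false = []

  ôw : List X → Bool
  ôw []      = true
  ôw (x ∷ w) = Data.Bool._∧_ (o x) (ôw w)

  δw : List X → A → List (List X)
  δw []      a = []
  δw (x ∷ w) a = (δ x a · ((w ∷ []))) ++ (i (o x) · δw w a)

  ô : List (List X) → Bool
  ô []      = false
  ô (s ∷ S) = Data.Bool._∨_ (ôw s) (ô S)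

  δ̂ : List (List X) → A → List (List X)
  δ̂ S a = concatMap (λ s → δw s a) S

-- Prefixing a nullable letter x only adds words to {w}_a: by definition
-- {xw}_a = x_a {w} ∪ i(o x) {w}_a, and when o x = 1 the second part is {ε}{w}_a = {w}_a.
-- Induction along the nullable prefix s gives {t}_a ⊆ {st}_a.
module Submission where

open import Defs
open import Data.Bool using (Bool; true)
open import Data.Nat using (ℕ)
open import Data.Fin using (Fin)
open import Data.Product using (∃)
open import Data.List using (List; []; _∷_; _++_; [_])
open import Data.List.Relation.Unary.All using (All; []; _∷_)
open import Data.List.Relation.Binary.Subset.Propositional using (_⊆_)
open import Data.List.Relation.Binary.Subset.Propositional.Properties
  using (⊆-reflexive; ⊆-refl; ⊆-trans; xs⊆ys++xs)
open import Data.List.Properties using (++-identityʳ; map-id)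
open import Function.Bundles using (_↔_)
open import Relation.Binary.PropositionalEquality using (_≡_; refl; sym; trans)

module _ {X A : Set} (o : X → Bool) (δ : X → A → List (List X)) where
  open Extension o δ

  ε·-identityˡ : (T : List (List X)) → i true · T ≡ T
  ε·-identityˡ T = trans (++-identityʳ _) (map-id T)

  δw-⊆-nullable-∷ : ∀ {x} → o x ≡ true → (w : List X) (a : A) → δw w a ⊆ δw (x ∷ w) a
  δw-⊆-nullable-∷ {x} ox w a rewrite ox =
    ⊆-trans (⊆-reflexive (sym (ε·-identityˡ (δw w a)))) (xs⊆ys++xs _ (δ x a · [ w ]))

  δw-⊆-nullable-++ : (s : List X) → All (λ x → o x ≡ true) s → (t : List X) (a : A)
                   → δw t a ⊆ δw (s ++ t) a
  δw-⊆-nullable-++ []      []        t a = ⊆-refl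
  δw-⊆-nullable-++ (x ∷ s) (ox ∷ os) t a =
    ⊆-trans (δw-⊆-nullable-++ s os t a) (δw-⊆-nullable-∷ ox (s ++ t) a)

  δ̂-singleton : (w : List X) (a : A) → δ̂ [ w ] a ≡ δw w a
  δ̂-singleton w a = ++-identityʳ (δw w a)

lemma3p4 : (A : Set) → (∃ λ (n : ℕ) → A ↔ Fin n) → (X : Set)
    → (o : X → Bool) → (δ : X → A → List (List X))
    → (s : List X) → All (λ x → o x ≡ true) s → (t : List X) → (a : A)
    → Extension.δ̂ o δ (t ∷ []) a ⊆ Extension.δ̂ o δ ((s ++ t) ∷ []) a
lemma3p4 A _ X o δ s nullable-s t a =
  ⊆-trans (⊆-reflexive (δ̂-singleton o δ t a))
    (⊆-trans (δw-⊆-nullable-++ o δ s nullable-s t a)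
             (⊆-reflexive (sym (δ̂-singleton o δ (s ++ t) a))))
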